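{- Let $\sigma$ be a proper schedule of $J$ and let $\sigma'$ be the intermediate schedule obtained from $\sigma$ by an admissible swap at step $j^*\in J$ between machines $M_h$ and $M_i$, with sets $J_H,J_I$ as in the definition of the swap. Writing $C_j$ and $C'_j$ for the completion time of job $j$ in $\sigma$ and $\sigma'$ respectively: 1. $C'_j=C_j$ for all $j\notin J_H\cup J_I$; 2. $C'_j\le C_j$ for all $j\in J_H$; 3. $C'_j\ge C_j$ for all $j\in J_I$.
   Context: Setting: $m$ identical parallel machines $M_1,\dots,M_m$ and jobs $J=\{1,\dots,n\}$ (indexed according to some fixed priority ordering); job $j$ has positive integer processing time $p_j$. Let $p_{\max}=\max_j p_j$; for $J'\subseteq J$ let $P(J')=\sum_{j\in J'}p_j$; let $J_j=\{1,\dots,j\}$. A proper schedule $\sigma$ is a partition $J=J_1(\sigma)\cup\dots\cup J_m(\sigma)$ ($J_i(\sigma)$ = jobs on $M_i$), where each machine processes its jobs from time $0$ without idle time in increasing order of index. Let $J_{i,j}(\sigma)=J_i(\sigma)\cap J_j$. In any schedule, each machine processes its jobs in a given sequence without idle time from time $0$, and $C_j$ is the time job $j$ finishes. The swap: let $\sigma$ be a proper schedule, $j^*\in J$, and $h,i\in\{1,\dots,m\}$. The swap is admissible for $\sigma$ at step $j^*$ (with machines $M_h,M_i$) if (i) $j^*\in J_{h}(\sigma)$; (ii) $|J_i(\sigma)\setminus J_{i,j^*}(\sigma)|\ge 2p_{\max}$; (iii) $P(J_{h,j^*}(\sigma))-P(J_{i,j^*}(\sigma))\ge 4p_{\max}^2$.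 In that case let $J_I$ be the first $2p_{\max}$ jobs (in processing order on $M_i$) of $J_i(\sigma)\setminus J_{i,j^*}(\sigma)$ and $J_H$ the last $2p_{\max}$ jobs (in processing order on $M_h$) of $J_{h,j^*}(\sigma)$. Choose nonempty $J_{H'}\subseteq J_H$ and $J_{I'}\subseteq J_I$ with $P(J_{H'})=P(J_{I'})$, and let $J_{H''}=J_H\setminus J_{H'}$, $J_{I''}=J_I\setminus J_{I'}$. The intermediate schedule $\sigma'$ changes only $M_h$ and $M_i$: on $M_h$ the consecutive block $J_H$ is replaced by the jobs of $J_{H''}$ (in their order in $\sigma$) followed by the jobs of $J_{I'}$ (in their order in $\sigma$); on $M_i$ the consecutive block $J_I$ is replaced by the jobs of $J_{H'}$ (in their order in $\sigma$) followed by the jobs of $J_{I''}$ (in their order in $\sigma$); all other jobs keep their machine and relative order, and machines process jobs without idle time. -}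

module Defs where

open import Data.Nat using (ℕ; _+_; _*_; _∸_; _⊔_; _≤_; _≤ᵇ_; _<ᵇ_)
open import Data.Fin using (Fin; toℕ; _≟_)
open import Data.Bool using (Bool; true; _∧_; not; if_then_else_)
open import Data.Nat.ListAction using (sum)
open import Data.List using (List; []; _∷_; _++_; map; foldr; filterᵇ; take; drop; length; allFin)
open import Data.List.Relation.Unary.Any using (Any)
open import Data.Product using (Σ; ∃; _×_)
open import Relation.Nullary.Decidable using (⌊_⌋)
open import Relation.Binary.PropositionalEquality using (_≡_)

-- Jobs are Fin n (index order = priority order), machines are Fin m.
-- A (general) schedule lists, for each machine, its jobs in processing order.
Schedule : ℕ → ℕ → Set
Schedule m n = Fin m → List (Fin n)

P : ∀ {n} → (Fin n → ℕ) → List (Fin n) → ℕ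
P p xs = sum (map p xs)

pmax : ∀ {n} → (Fin n → ℕ) → ℕ
pmax {n} p = foldr _⊔_ 0 (map p (allFin n))

-- A proper schedule is given by the partition (assignment a : job ↦ machine);
-- each machine processes its jobs in increasing index order.
properSched : ∀ {m n} → (Fin n → Fin m) → Schedule m n
properSched {m} {n} a i = filterᵇ (λ k → ⌊ a k ≟ i ⌋) (allFin n)

upto : ∀ {m n} → (Fin n → Fin m) → Fin m → Fin n → List (Fin n)
upto {m} {n} a i j* = filterᵇ (λ k → ⌊ a k ≟ i ⌋ ∧ (toℕ k ≤ᵇ toℕ j*)) (allFin n)

after : ∀ {m n} → (Fin n → Fin m) → Fin m → Fin n → List (Fin n)
after {m} {n} a i j* = filterᵇ (λ k → ⌊ a k ≟ i ⌋ ∧ (toℕ j* <ᵇ toℕ k)) (allFin n)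

Admissible : ∀ {m n} → (Fin n → ℕ) → (Fin n → Fin m) → Fin n → Fin m → Fin m → Set
Admissible p a j* h i =
  (a j* ≡ h)
  × (2 * pmax p ≤ length (after a i j*))
  × (P p (upto a i j*) + 4 * (pmax p * pmax p) ≤ P p (upto a h j*))

JI : ∀ {m n} → (Fin n → ℕ) → (Fin n → Fin m) → Fin n → Fin m → List (Fin n)
JI p a j* i = take (2 * pmax p) (after a i j*)

Hpre : ∀ {m n} → (Fin n → ℕ) → (Fin n → Fin m) → Fin n → Fin m → List (Fin n)
Hpre p a j* h = take (length (upto a h j*) ∸ 2 * pmax p) (upto a h j*)

JH : ∀ {m n} → (Fin n → ℕ) → (Fin n → Fin m) → Fin n → Fin m → List (Fin n)
JH p a j* h = drop (length (upto a h j*) ∸ 2 * pmax p) (upto a h j*)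

-- Subsets J_{H'} ⊆ J_H, J_{I'} ⊆ J_I are given by selectors H', I' : jobs → Bool
-- (J_{H'} = the jobs of J_H selected by H', J_{H''} = the others; same for I).
ValidChoice : ∀ {m n} → (Fin n → ℕ) → (Fin n → Fin m) → Fin n → Fin m → Fin m
            → (Fin n → Bool) → (Fin n → Bool) → Set
ValidChoice p a j* h i H' I' =
  Any (λ k → H' k ≡ true) (JH p a j* h)
  × Any (λ k → I' k ≡ true) (JI p a j* i)
  × (P p (filterᵇ H' (JH p a j* h)) ≡ P p (filterᵇ I' (JI p a j* i)))

intermediate : ∀ {m n} → (Fin n → ℕ) → (Fin n → Fin m) → Fin n → Fin m → Fin m
             → (Fin n → Bool) → (Fin n → Bool) → Schedule m n
intermediate p a j* h i H' I' k =
  if ⌊ k ≟ h ⌋ then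
    Hpre p a j* h ++ filterᵇ (λ x → not (H' x)) (JH p a j* h)
                 ++ filterᵇ I' (JI p a j* i) ++ after a h j*
  else if ⌊ k ≟ i ⌋ then
    upto a i j* ++ filterᵇ H' (JH p a j* h)
                ++ filterᵇ (λ x → not (I' x)) (JI p a j* i)
                ++ drop (2 * pmax p) (after a i j*)
  else properSched a k

-- C_j = c in schedule S: j is processed on some machine M_k, preceded by xs,
-- and (no idle time from 0) finishes at P(xs) + p_j.
CompletionTime : ∀ {m n} → (Fin n → ℕ) → Schedule m n → Fin n → ℕ → Set
CompletionTime {m} {n} p S j c =
  Σ (Fin m) λ k → Σ (List (Fin n)) λ xs → Σ (List (Fin n)) λ ys →
    (S k ≡ xs ++ j ∷ ys) × (c ≡ P p xs + p j)

{-# OPTIONS --safe #-}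
-- Outside the blocks J_H and J_I nothing changes: every other job keeps its machine and the
-- total processing time in front of it, since on M_h the part J_H' of J_H is replaced by J_I'
-- and on M_i the part J_I' of J_I by J_H', and P(J_H') = P(J_I').
-- A job of J_H'' stays on M_h and is now preceded by only part of what preceded it, so it
-- finishes no later; a job of J_I'' stays on M_i and the jobs of J_I' before it are replaced
-- by all of J_H', of the same total, so it finishes no earlier.
-- For the moved jobs, P(J_H), P(J_I) ≤ 2 p_max² turns condition (iii) into
-- P(J_{i,j*}) + 2 p_max² ≤ P(jobs of M_h before J_H): everything M_i processes up to the end
-- of J_I or of J_H' is done before M_h reaches J_H, so a job moved from J_H to M_i finishes
-- no later and a job moved from J_I to M_h no earlier.
module Submission where

open import Defs
open import Data.Nat using (ℕ; zero; suc; _+_; _*_; _∸_; _⊔_; _≤_; _<ᵇ_; _≤ᵇ_; z≤n)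
open import Data.Nat.Properties
  using ( +-commutativeSemigroup; ≤-trans; ≤-reflexive; <⇒≤; <-≤-trans; ≤ᵇ⇒≤; ≤⇒≤ᵇ
        ; m≤m+n; m≤m⊔n; m≤n⊔m; m+1+n≰m; m≤n+o⇒m∸n≤o; m≤n+m∸n; m⊓n≤m
        ; *-monoˡ-≤; *-assoc; *-distribʳ-+; +-cancelʳ-≤; +-assoc; +-comm
        ; +-mono-≤; +-monoˡ-≤; +-monoʳ-≤; module ≤-Reasoning )
open import Data.Nat.ListAction using (sum)
open import Algebra.Properties.CommutativeSemigroup +-commutativeSemigroup using (x∙yz≈y∙xz)
open import Data.Nat.ListAction.Properties using (sum-++)
open import Data.Fin using (Fin; toℕ; _≟_)
open import Data.Bool using (Bool; true; false; not; _∧_; if_then_else_; T)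
open import Data.Bool.Properties using (T?; T-∧)
open import Function.Bundles using (Equivalence)
open import Data.Unit using (tt)
open import Data.Empty using (⊥-elim)
open import Data.Sum using (_⊎_; inj₁; inj₂)
open import Data.Product using (Σ; ∃; _×_; _,_; proj₁; proj₂)
open import Data.List using (List; []; _∷_; _++_; map; foldr; filterᵇ; drop; length; allFin)
open import Data.List.Properties
  using ( ∷-injectiveˡ; ∷-injectiveʳ; ++-assoc; map-++; take++drop≡id; length-take; length-drop
        ; filter-++; filter-accept; filter-none; filter-≐ )
open import Data.List.Relation.Unary.Any using (here; there)
open import Data.List.Relation.Unary.All as All using (All; []; _∷_)
open import Data.List.Relation.Unary.All.Properties using (All¬⇒¬Any)
open import Data.List.Relation.Unary.AllPairs using (AllPairs; []; _∷_)
import Data.List.Relation.Unary.AllPairs.Properties as AP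
open import Data.List.Relation.Unary.Unique.Propositional using (Unique)
import Data.List.Relation.Unary.Unique.Propositional.Properties as UP
open import Data.List.Membership.Propositional using (_∈_; _∉_)
open import Data.List.Membership.Propositional.Properties
  using (∈-++⁺ˡ; ∈-++⁺ʳ; ∈-++⁻; ∈-∃++; ∈-filter⁺; ∈-filter⁻; ∈-map⁺; ∈-allFin)
open import Relation.Nullary using (¬_; Dec; yes; no; contradiction)
open import Relation.Nullary.Decidable using (⌊_⌋; toWitness; fromWitness)
open import Relation.Binary.PropositionalEquality
open import Function using (_∘_)

private variable A : Set

++-∷-split : ∀ (L₁ : List A) {L₂ xs ys j} → L₁ ++ L₂ ≡ xs ++ j ∷ ys →
  (∃ λ r → L₁ ≡ xs ++ j ∷ r) ⊎ (∃ λ u → xs ≡ L₁ ++ u × L₂ ≡ u ++ j ∷ ys)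
++-∷-split []       {xs = xs}    e    = inj₂ (xs , refl , e)
++-∷-split (x ∷ L₁) {xs = []}    refl = inj₁ (L₁ , refl)
++-∷-split (x ∷ L₁) {xs = y ∷ xs} e with refl ← ∷-injectiveˡ e | ++-∷-split L₁ (∷-injectiveʳ e)
... | inj₁ (r , e₁)      = inj₁ (r , cong (x ∷_) e₁)
... | inj₂ (u , e₁ , e₂) = inj₂ (u , cong (x ∷_) e₁ , e₂)

prefix-unique : ∀ {j : A} xs ys xs′ ys′ → Unique (xs ++ j ∷ ys) →
  xs ++ j ∷ ys ≡ xs′ ++ j ∷ ys′ → xs ≡ xs′
prefix-unique []       _  []         _   _ _ = refl
prefix-unique [] _ (x′ ∷ xs′) ys′ (j∉ ∷ _) refl = ⊥-elim (All¬⇒¬Any j∉ (∈-++⁺ʳ xs′ (here refl)))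
prefix-unique (x ∷ xs) ys [] _ (j∉ ∷ _) refl = ⊥-elim (All¬⇒¬Any j∉ (∈-++⁺ʳ xs (here refl)))
prefix-unique (x ∷ xs) ys (x′ ∷ xs′) ys′ (_ ∷ u) e =
  cong₂ _∷_ (∷-injectiveˡ e) (prefix-unique xs ys xs′ ys′ u (∷-injectiveʳ e))

filterᵇ-∧-reject : (f g : A → Bool) {xs : List A} → All (λ y → ¬ T (g y)) xs →
  filterᵇ (λ x → f x ∧ g x) xs ≡ []
filterᵇ-∧-reject f g ¬g =
  filter-none (T? ∘ λ x → f x ∧ g x) (All.map (λ ¬gx → ¬gx ∘ proj₂ ∘ Equivalence.to T-∧) ¬g)

filterᵇ-∧-not-accept : (f g : A → Bool) {xs : List A} → All (λ y → ¬ T (g y)) xs →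
  filterᵇ (λ x → f x ∧ not (g x)) xs ≡ filterᵇ f xs
filterᵇ-∧-not-accept f g [] = refl
filterᵇ-∧-not-accept f g {x ∷ xs} (¬gx ∷ ¬g) with g x | f x
... | true  | _     = ⊥-elim (¬gx tt)
... | false | true  = cong (x ∷_) (filterᵇ-∧-not-accept f g ¬g)
... | false | false = filterᵇ-∧-not-accept f g ¬g

-- Once g fails along the list it keeps failing, so the g-part of a filter is a prefix.
filterᵇ-split : (f g : A → Bool) {xs : List A} → AllPairs (λ x y → T (g y) → T (g x)) xs →
  filterᵇ (λ x → f x ∧ g x) xs ++ filterᵇ (λ x → f x ∧ not (g x)) xs ≡ filterᵇ f xs
filterᵇ-split f g [] = refl
filterᵇ-split f g {x ∷ xs} (g⇒gx ∷ antitone) with g x | f x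
... | true  | true  = cong (x ∷_) (filterᵇ-split f g antitone)
... | true  | false = filterᵇ-split f g antitone
... | false | true  =
  cong₂ (λ u v → u ++ x ∷ v) (filterᵇ-∧-reject f g g⇒gx) (filterᵇ-∧-not-accept f g g⇒gx)
... | false | false = cong₂ _++_ (filterᵇ-∧-reject f g g⇒gx) (filterᵇ-∧-not-accept f g g⇒gx)

∈-filterᵇ-⊎ : (f : A → Bool) {x : A} {xs : List A} → x ∈ xs →
  x ∈ filterᵇ f xs ⊎ x ∈ filterᵇ (not ∘ f) xs
∈-filterᵇ-⊎ f {x} x∈xs with f x in fx
... | true  = inj₁ (∈-filter⁺ (T? ∘ f) x∈xs (subst T (sym fx) tt))
... | false = inj₂ (∈-filter⁺ (T? ∘ (not ∘ f)) x∈xs (subst (T ∘ not) (sym fx) tt))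

not-≤ᵇ : ∀ m n → not (m ≤ᵇ n) ≡ (n <ᵇ m)
not-≤ᵇ zero          n       = refl
not-≤ᵇ (suc m)       zero    = refl
not-≤ᵇ (suc zero)    (suc n) = refl
not-≤ᵇ (suc (suc m)) (suc n) = not-≤ᵇ (suc m) n

if-⌊⌋-yes : ∀ {B : Set} (d : Dec A) {x y : B} → A → (if ⌊ d ⌋ then x else y) ≡ x
if-⌊⌋-yes (yes _) _  = refl
if-⌊⌋-yes (no ¬a) a = contradiction a ¬a

if-⌊⌋-no : ∀ {B : Set} (d : Dec A) {x y : B} → ¬ A → (if ⌊ d ⌋ then x else y) ≡ y
if-⌊⌋-no (yes a) ¬a = contradiction a ¬a
if-⌊⌋-no (no _)  _  = refl

pmax-≤ : ∀ {n} (p : Fin n → ℕ) j → p j ≤ pmax p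
pmax-≤ {n} p j = foldr-⊔-≤ (∈-map⁺ p (∈-allFin j))
  where
  foldr-⊔-≤ : ∀ {x ys} → x ∈ ys → x ≤ foldr _⊔_ 0 ys
  foldr-⊔-≤ {ys = y ∷ _}  (here refl) = m≤m⊔n y _
  foldr-⊔-≤ {ys = y ∷ _}  (there x∈) = ≤-trans (foldr-⊔-≤ x∈) (m≤n⊔m y _)

module _ {n : ℕ} (p : Fin n → ℕ) where

  P-++ : ∀ (xs ys : List (Fin n)) → P p (xs ++ ys) ≡ P p xs + P p ys
  P-++ xs ys = trans (cong sum (map-++ p xs ys)) (sum-++ (map p xs) (map p ys))

  P-filterᵇ-partition : (f : Fin n → Bool) (xs : List (Fin n)) →
    P p (filterᵇ f xs) + P p (filterᵇ (not ∘ f) xs) ≡ P p xs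
  P-filterᵇ-partition f [] = refl
  P-filterᵇ-partition f (x ∷ xs) with f x
  ... | true  = trans (+-assoc (p x) _ _) (cong (p x +_) (P-filterᵇ-partition f xs))
  ... | false = trans (x∙yz≈y∙xz (P p (filterᵇ f xs)) (p x) (P p (filterᵇ (not ∘ f) xs)))
                      (cong (p x +_) (P-filterᵇ-partition f xs))

  P-filterᵇ-≤ : (f : Fin n → Bool) (xs : List (Fin n)) → P p (filterᵇ f xs) ≤ P p xs
  P-filterᵇ-≤ f xs = subst (P p (filterᵇ f xs) ≤_) (P-filterᵇ-partition f xs) (m≤m+n _ _)

  P-≤-length* : ∀ {B} → (∀ j → p j ≤ B) → (xs : List (Fin n)) → P p xs ≤ length xs * B
  P-≤-length* p≤B []       = z≤n
  P-≤-length* p≤B (x ∷ xs) = +-mono-≤ (p≤B x) (P-≤-length* p≤B xs)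

-- CompletionTime p S j c is definitionally Σ k (CompletionTimeOn p (S k) j c).
CompletionTimeOn : ∀ {n} → (Fin n → ℕ) → List (Fin n) → Fin n → ℕ → Set
CompletionTimeOn {n} p L j c =
  Σ (List (Fin n)) λ xs → Σ (List (Fin n)) λ ys → (L ≡ xs ++ j ∷ ys) × (c ≡ P p xs + p j)

module _ {n : ℕ} (p : Fin n → ℕ) where

  private
    P-++-+ : ∀ (xs ys : List (Fin n)) t → P p (xs ++ ys) + t ≡ P p xs + (P p ys + t)
    P-++-+ xs ys t = trans (cong (_+ t) (P-++ p xs ys)) (+-assoc (P p xs) (P p ys) t)

  ∈⇒completionTimeOn : ∀ {L j} → j ∈ L → ∃ (CompletionTimeOn p L j)
  ∈⇒completionTimeOn {j = j} j∈L with xs , ys , e ← ∈-∃++ j∈L = P p xs + p j , xs , ys , e , refl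

  completionTimeOn⇒∈ : ∀ {L j c} → CompletionTimeOn p L j c → j ∈ L
  completionTimeOn⇒∈ (xs , _ , refl , _) = ∈-++⁺ʳ xs (here refl)

  completionTimeOn-filterᵇ⇒∈ : ∀ f {xs : List (Fin n)} {j c} →
    CompletionTimeOn p (filterᵇ f xs) j c → j ∈ xs
  completionTimeOn-filterᵇ⇒∈ f {xs} t = proj₁ (∈-filter⁻ (T? ∘ f) {xs = xs} (completionTimeOn⇒∈ t))

  completionTimeOn-≤ : ∀ {L j c} → CompletionTimeOn p L j c → c ≤ P p L
  completionTimeOn-≤ {j = j} (xs , ys , refl , refl) = begin
    P p xs + p j              ≤⟨ m≤m+n _ (P p ys) ⟩
    P p xs + p j + P p ys     ≡⟨ +-assoc (P p xs) (p j) (P p ys) ⟩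
    P p xs + P p (j ∷ ys)     ≡⟨ P-++ p xs (j ∷ ys) ⟨
    P p (xs ++ j ∷ ys)        ∎
    where open ≤-Reasoning

  completionTimeOn-unique : ∀ {L j c c′} → Unique L →
    CompletionTimeOn p L j c → CompletionTimeOn p L j c′ → c ≡ c′
  completionTimeOn-unique {j = j} u (xs , ys , refl , refl) (xs′ , ys′ , e , refl) =
    cong (λ zs → P p zs + p j) (prefix-unique xs ys xs′ ys′ u e)

  completionTimeOn-++ˡ : ∀ {L₁ L₂ j c} → CompletionTimeOn p L₁ j c → CompletionTimeOn p (L₁ ++ L₂) j c
  completionTimeOn-++ˡ {L₂ = L₂} {j} (xs , ys , refl , refl) =
    xs , ys ++ L₂ , ++-assoc xs (j ∷ ys) L₂ , refl

  completionTimeOn-++ʳ : ∀ L₁ {L₂ j c} →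
    CompletionTimeOn p L₂ j c → CompletionTimeOn p (L₁ ++ L₂) j (P p L₁ + c)
  completionTimeOn-++ʳ L₁ {j = j} (xs , ys , refl , refl) =
    L₁ ++ xs , ys , sym (++-assoc L₁ xs (j ∷ ys)) , sym (P-++-+ L₁ xs (p j))

  completionTimeOn-++⁻ : ∀ L₁ {L₂ j c} → CompletionTimeOn p (L₁ ++ L₂) j c →
    CompletionTimeOn p L₁ j c ⊎ ∃ λ c₂ → CompletionTimeOn p L₂ j c₂ × c ≡ P p L₁ + c₂
  completionTimeOn-++⁻ L₁ {j = j} (xs , ys , e , refl) with ++-∷-split L₁ e
  ... | inj₁ (r , e₁)         = inj₁ (xs , r , e₁ , refl)
  ... | inj₂ (u , refl , e₂) = inj₂ (P p u + p j , (u , ys , e₂ , refl) , P-++-+ L₁ u (p j))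

  completionTimeOn-filterᵇ : (f : Fin n → Bool) (v w : List (Fin n)) {j : Fin n} {c : ℕ} →
    Unique (v ++ j ∷ w) → CompletionTimeOn p (filterᵇ f (v ++ j ∷ w)) j c → c ≡ P p (filterᵇ f v) + p j
  completionTimeOn-filterᵇ f v w {j} u t =
    completionTimeOn-unique (UP.filter⁺ (T? ∘ f) u) t (filterᵇ f v , filterᵇ f w , split , refl)
    where
    fj : T (f j)
    fj = proj₂ (∈-filter⁻ (T? ∘ f) {xs = v ++ j ∷ w} (completionTimeOn⇒∈ t))
    split : filterᵇ f (v ++ j ∷ w) ≡ filterᵇ f v ++ j ∷ filterᵇ f w
    split = trans (filter-++ (T? ∘ f) v (j ∷ w)) (cong (filterᵇ f v ++_) (filter-accept (T? ∘ f) fj))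

  completionTimeOn-filterᵇ-≤ : (f : Fin n → Bool) {L : List (Fin n)} {j : Fin n} {c c′ : ℕ} →
    Unique L → CompletionTimeOn p L j c → CompletionTimeOn p (filterᵇ f L) j c′ → c′ ≤ c
  completionTimeOn-filterᵇ-≤ f {j = j} u (v , w , refl , refl) t′ = begin
    _                         ≡⟨ completionTimeOn-filterᵇ f v w u t′ ⟩
    P p (filterᵇ f v) + p j   ≤⟨ +-monoˡ-≤ (p j) (P-filterᵇ-≤ p f v) ⟩
    P p v + p j               ∎
    where open ≤-Reasoning

  completionTimeOn-filterᵇ-not-≥ : (f : Fin n → Bool) {L : List (Fin n)} {j : Fin n} {c c′ : ℕ} →
    Unique L → CompletionTimeOn p L j c → CompletionTimeOn p (filterᵇ (not ∘ f) L) j c′ →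
    c ≤ P p (filterᵇ f L) + c′
  completionTimeOn-filterᵇ-not-≥ f {j = j} u (v , w , refl , refl) t′ = begin
    P p v + p j
      ≡⟨ cong (_+ p j) (P-filterᵇ-partition p f v) ⟨
    P p (filterᵇ f v) + P p (filterᵇ (not ∘ f) v) + p j
      ≡⟨ +-assoc (P p (filterᵇ f v)) _ (p j) ⟩
    P p (filterᵇ f v) + (P p (filterᵇ (not ∘ f) v) + p j)
      ≤⟨ +-monoˡ-≤ _ (P-filterᵇ-≤-++ v (j ∷ w)) ⟩
    P p (filterᵇ f (v ++ j ∷ w)) + (P p (filterᵇ (not ∘ f) v) + p j)
      ≡⟨ cong (P p (filterᵇ f (v ++ j ∷ w)) +_) (completionTimeOn-filterᵇ (not ∘ f) v w u t′) ⟨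
    P p (filterᵇ f (v ++ j ∷ w)) + _ ∎
    where
    open ≤-Reasoning
    P-filterᵇ-≤-++ : (xs ys : List (Fin n)) → P p (filterᵇ f xs) ≤ P p (filterᵇ f (xs ++ ys))
    P-filterᵇ-≤-++ xs ys = subst (P p (filterᵇ f xs) ≤_)
      (sym (trans (cong (P p) (filter-++ (T? ∘ f) xs ys)) (P-++ p (filterᵇ f xs) (filterᵇ f ys))))
      (m≤m+n _ _)

module _ {m n : ℕ} (a : Fin n → Fin m) where

  properSched-unique : ∀ k → Unique (properSched a k)
  properSched-unique k = UP.filter⁺ _ (UP.allFin⁺ n)

  ∈-properSched : ∀ j → j ∈ properSched a (a j)
  ∈-properSched j = ∈-filter⁺ (T? ∘ λ x → ⌊ a x ≟ a j ⌋) (∈-allFin j) (fromWitness refl)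

  properSched-assignment : ∀ {k j} → j ∈ properSched a k → a j ≡ k
  properSched-assignment {k} j∈ =
    toWitness (proj₂ (∈-filter⁻ (T? ∘ λ x → ⌊ a x ≟ k ⌋) {xs = allFin n} j∈))

  properSched-split : ∀ k j* → properSched a k ≡ upto a k j* ++ after a k j*
  properSched-split k j* = sym (trans (cong (upto a k j* ++_) after≡) (filterᵇ-split on-k ≤j* antitone))
    where
    on-k ≤j* : Fin n → Bool
    on-k x = ⌊ a x ≟ k ⌋
    ≤j* x = toℕ x ≤ᵇ toℕ j*
    antitone : AllPairs (λ x y → T (≤j* y) → T (≤j* x)) (allFin n)
    antitone = AP.tabulate⁺-< λ x<y y≤ → ≤⇒≤ᵇ (<⇒≤ (<-≤-trans x<y (≤ᵇ⇒≤ _ _ y≤)))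
    after≡ : after a k j* ≡ filterᵇ (λ x → on-k x ∧ not (≤j* x)) (allFin n)
    after≡ = filter-≐ (T? ∘ _) (T? ∘ _)
      ((λ {x} → subst (λ b → T (on-k x ∧ b)) (sym (not-≤ᵇ (toℕ x) (toℕ j*))))
      , (λ {x} → subst (λ b → T (on-k x ∧ b)) (not-≤ᵇ (toℕ x) (toℕ j*))))
      (allFin n)

module _ {m n : ℕ} (p : Fin n → ℕ) (a : Fin n → Fin m) where

  completionTime-properSched-exists : ∀ j → ∃ (CompletionTime p (properSched a) j)
  completionTime-properSched-exists j
    with c , t ← ∈⇒completionTimeOn p (∈-properSched a j) = c , a j , t

  completionTime-properSched-unique : ∀ {j c k c₀} → CompletionTime p (properSched a) j c →
    CompletionTimeOn p (properSched a k) j c₀ → c ≡ c₀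
  completionTime-properSched-unique (_ , t) t₀
    with refl ← properSched-assignment a (completionTimeOn⇒∈ p t)
       | refl ← properSched-assignment a (completionTimeOn⇒∈ p t₀)
    = completionTimeOn-unique p (properSched-unique a _) t t₀

-- Only condition (iii) of admissibility (which forces h ≠ i, as p_max ≥ 1) and
-- P(J_H') = P(J_I') enter the argument.
module Swap {m n : ℕ} (p : Fin n → ℕ) (p≥1 : ∀ j → 1 ≤ p j)
  (a : Fin n → Fin m) (j* : Fin n) (h i : Fin m)
  (gap : P p (upto a i j*) + 4 * (pmax p * pmax p) ≤ P p (upto a h j*))
  (H′ I′ : Fin n → Bool) (balanced : P p (filterᵇ H′ (JH p a j* h)) ≡ P p (filterᵇ I′ (JI p a j* i)))
  where

  σ σ′ : Schedule m n
  σ  = properSched a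
  σ′ = intermediate p a j* h i H′ I′

  pmax² : ℕ
  pmax² = pmax p * pmax p

  beforeH J-H afterH beforeI J-I afterI J-H′ J-H″ J-I′ J-I″ : List (Fin n)
  beforeH = Hpre p a j* h
  J-H     = JH p a j* h
  afterH  = after a h j*
  beforeI = upto a i j*
  J-I     = JI p a j* i
  afterI  = drop (2 * pmax p) (after a i j*)
  J-H′    = filterᵇ H′ J-H
  J-H″    = filterᵇ (not ∘ H′) J-H
  J-I′    = filterᵇ I′ J-I
  J-I″    = filterᵇ (not ∘ I′) J-I

  upto-h : upto a h j* ≡ beforeH ++ J-H
  upto-h = sym (take++drop≡id (length (upto a h j*) ∸ 2 * pmax p) (upto a h j*))

  σ-h : σ h ≡ beforeH ++ J-H ++ afterH
  σ-h = begin
    σ h                                ≡⟨ properSched-split a h j* ⟩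
    upto a h j* ++ afterH              ≡⟨ cong (_++ afterH) upto-h ⟩
    (beforeH ++ J-H) ++ afterH         ≡⟨ ++-assoc beforeH J-H afterH ⟩
    beforeH ++ J-H ++ afterH           ∎
    where open ≡-Reasoning

  σ-i : σ i ≡ beforeI ++ J-I ++ afterI
  σ-i = trans (properSched-split a i j*)
              (cong (beforeI ++_) (sym (take++drop≡id (2 * pmax p) (after a i j*))))

  h≢i : h ≢ i
  h≢i refl with pmax p | ≤-trans (p≥1 j*) (pmax-≤ p j*)
  ... | suc _ | _ = m+1+n≰m _ gap

  σ′-h : σ′ h ≡ beforeH ++ J-H″ ++ J-I′ ++ afterH
  σ′-h = if-⌊⌋-yes (h ≟ h) refl

  σ′-i : σ′ i ≡ beforeI ++ J-H′ ++ J-I″ ++ afterI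
  σ′-i = trans (if-⌊⌋-no (i ≟ h) (h≢i ∘ sym)) (if-⌊⌋-yes (i ≟ i) refl)

  σ′-other : ∀ {k} → k ≢ h → k ≢ i → σ′ k ≡ σ k
  σ′-other {k} k≢h k≢i = trans (if-⌊⌋-no (k ≟ h) k≢h) (if-⌊⌋-no (k ≟ i) k≢i)

  P-block-≤ : (xs : List (Fin n)) → length xs ≤ 2 * pmax p → P p xs ≤ 2 * pmax²
  P-block-≤ xs len≤ = begin
    P p xs                     ≤⟨ P-≤-length* p (pmax-≤ p) xs ⟩
    length xs * pmax p         ≤⟨ *-monoˡ-≤ (pmax p) len≤ ⟩
    2 * pmax p * pmax p        ≡⟨ *-assoc 2 (pmax p) (pmax p) ⟩
    2 * pmax²                  ∎
    where open ≤-Reasoning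

  P-J-H-≤ : P p J-H ≤ 2 * pmax²
  P-J-H-≤ = P-block-≤ J-H (begin
    length J-H                      ≡⟨ length-drop (ℓ ∸ 2 * pmax p) (upto a h j*) ⟩
    ℓ ∸ (ℓ ∸ 2 * pmax p)            ≤⟨ m≤n+o⇒m∸n≤o ℓ (ℓ ∸ 2 * pmax p) ℓ≤ ⟩
    2 * pmax p                      ∎)
    where
    open ≤-Reasoning
    ℓ : ℕ
    ℓ = length (upto a h j*)
    ℓ≤ : ℓ ≤ (ℓ ∸ 2 * pmax p) + 2 * pmax p
    ℓ≤ = subst (ℓ ≤_) (+-comm (2 * pmax p) _) (m≤n+m∸n ℓ (2 * pmax p))

  P-J-I-≤ : P p J-I ≤ 2 * pmax²
  P-J-I-≤ = P-block-≤ J-I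
    (subst (_≤ 2 * pmax p) (sym (length-take (2 * pmax p) (after a i j*))) (m⊓n≤m _ _))

  lead : P p beforeI + 2 * pmax² ≤ P p beforeH
  lead = +-cancelʳ-≤ (2 * pmax²) _ _ (begin
    P p beforeI + 2 * pmax² + 2 * pmax²     ≡⟨ +-assoc (P p beforeI) _ _ ⟩
    P p beforeI + (2 * pmax² + 2 * pmax²)   ≡⟨ cong (P p beforeI +_) (*-distribʳ-+ pmax² 2 2) ⟨
    P p beforeI + 4 * pmax²                 ≤⟨ gap ⟩
    P p (upto a h j*)                       ≡⟨ cong (P p) upto-h ⟩
    P p (beforeH ++ J-H)                    ≡⟨ P-++ p beforeH J-H ⟩
    P p beforeH + P p J-H                   ≤⟨ +-monoʳ-≤ (P p beforeH) P-J-H-≤ ⟩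
    P p beforeH + 2 * pmax²                 ∎)
    where open ≤-Reasoning

  J-H-unique : Unique J-H
  J-H-unique = UP.drop⁺ (length (upto a h j*) ∸ 2 * pmax p) (UP.filter⁺ _ (UP.allFin⁺ n))

  J-I-unique : Unique J-I
  J-I-unique = UP.take⁺ (2 * pmax p) (UP.filter⁺ _ (UP.allFin⁺ n))

  J-H-on-h : ∀ {j} → j ∈ J-H → a j ≡ h
  J-H-on-h {j} j∈ = properSched-assignment a (subst (j ∈_) (sym σ-h) (∈-++⁺ʳ beforeH (∈-++⁺ˡ j∈)))

  J-I-on-i : ∀ {j} → j ∈ J-I → a j ≡ i
  J-I-on-i {j} j∈ = properSched-assignment a (subst (j ∈_) (sym σ-i) (∈-++⁺ʳ beforeI (∈-++⁺ˡ j∈)))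

  σ-time : ∀ {j c k L c₀} → CompletionTime p σ j c → σ k ≡ L → CompletionTimeOn p L j c₀ → c ≡ c₀
  σ-time {j} {c₀ = c₀} t e t₀ =
    completionTime-properSched-unique p a t (subst (λ L → CompletionTimeOn p L j c₀) (sym e) t₀)

  σ-time-J-H : ∀ f {j c c₁} → CompletionTime p σ j c → CompletionTimeOn p (filterᵇ f J-H) j c₁ →
    ∃ λ c₀ → CompletionTimeOn p J-H j c₀ × c ≡ P p beforeH + c₀
  σ-time-J-H f t t₁ with c₀ , t₀ ← ∈⇒completionTimeOn p (completionTimeOn-filterᵇ⇒∈ p f t₁) =
    c₀ , t₀ , σ-time t σ-h (completionTimeOn-++ʳ p beforeH (completionTimeOn-++ˡ p t₀))

  σ-time-J-I : ∀ f {j c c₁} → CompletionTime p σ j c → CompletionTimeOn p (filterᵇ f J-I) j c₁ →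
    ∃ λ c₀ → CompletionTimeOn p J-I j c₀ × c ≡ P p beforeI + c₀
  σ-time-J-I f t t₁ with c₀ , t₀ ← ∈⇒completionTimeOn p (completionTimeOn-filterᵇ⇒∈ p f t₁) =
    c₀ , t₀ , σ-time t σ-i (completionTimeOn-++ʳ p beforeI (completionTimeOn-++ˡ p t₀))

  σ-time-afterH : ∀ {j c c₀} → CompletionTime p σ j c → CompletionTimeOn p afterH j c₀ →
    c ≡ P p beforeH + (P p J-H + c₀)
  σ-time-afterH t t₀ = σ-time t σ-h (completionTimeOn-++ʳ p beforeH (completionTimeOn-++ʳ p J-H t₀))

  σ-time-afterI : ∀ {j c c₀} → CompletionTime p σ j c → CompletionTimeOn p afterI j c₀ →
    c ≡ P p beforeI + (P p J-I + c₀)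
  σ-time-afterI t t₀ = σ-time t σ-i (completionTimeOn-++ʳ p beforeI (completionTimeOn-++ʳ p J-I t₀))

  P-J-H″+P-J-I′ : P p J-H″ + P p J-I′ ≡ P p J-H
  P-J-H″+P-J-I′ = trans (cong (P p J-H″ +_) (sym balanced))
                        (trans (+-comm (P p J-H″) (P p J-H′)) (P-filterᵇ-partition p H′ J-H))

  P-J-H′+P-J-I″ : P p J-H′ + P p J-I″ ≡ P p J-I
  P-J-H′+P-J-I″ = trans (cong (_+ P p J-I″) balanced) (P-filterᵇ-partition p I′ J-I)

  SwapEffect : Fin n → ℕ → ℕ → Set
  SwapEffect j c c′ = (j ∉ J-H → j ∉ J-I → c′ ≡ c) × (j ∈ J-H → c′ ≤ c) × (j ∈ J-I → c ≤ c′)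

  J-H∩J-I-empty : ∀ {j} → j ∈ J-H → j ∉ J-I
  J-H∩J-I-empty j∈J-H j∈J-I = h≢i (trans (sym (J-H-on-h j∈J-H)) (J-I-on-i j∈J-I))

  unchanged : ∀ {j c c′} → c′ ≡ c → SwapEffect j c c′
  unchanged c′≡c = (λ _ _ → c′≡c) , (λ _ → ≤-reflexive c′≡c) , (λ _ → ≤-reflexive (sym c′≡c))

  advanced : ∀ {j c c′} → j ∈ J-H → c′ ≤ c → SwapEffect j c c′
  advanced j∈J-H c′≤c = (λ j∉J-H _ → contradiction j∈J-H j∉J-H) , (λ _ → c′≤c)
                      , (λ j∈J-I → contradiction j∈J-I (J-H∩J-I-empty j∈J-H))

  delayed : ∀ {j c c′} → j ∈ J-I → c ≤ c′ → SwapEffect j c c′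
  delayed j∈J-I c≤c′ = (λ _ j∉J-I → contradiction j∈J-I j∉J-I)
                     , (λ j∈J-H → contradiction j∈J-I (J-H∩J-I-empty j∈J-H)) , (λ _ → c≤c′)

  kept-J-H″ : ∀ {j c c₁} → CompletionTime p σ j c → CompletionTimeOn p J-H″ j c₁ →
    SwapEffect j c (P p beforeH + c₁)
  kept-J-H″ t t₁ with c₀ , t₀ , refl ← σ-time-J-H (not ∘ H′) t t₁ =
    advanced (completionTimeOn⇒∈ p t₀)
      (+-monoʳ-≤ (P p beforeH) (completionTimeOn-filterᵇ-≤ p (not ∘ H′) J-H-unique t₀ t₁))

  kept-J-I″ : ∀ {j c c₁} → CompletionTime p σ j c → CompletionTimeOn p J-I″ j c₁ →
    SwapEffect j c (P p beforeI + (P p J-H′ + c₁))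
  kept-J-I″ {c₁ = c₁} t t₁ with c₀ , t₀ , refl ← σ-time-J-I (not ∘ I′) t t₁ =
    delayed (completionTimeOn⇒∈ p t₀) (begin
      P p beforeI + c₀
        ≤⟨ +-monoʳ-≤ _ (completionTimeOn-filterᵇ-not-≥ p I′ J-I-unique t₀ t₁) ⟩
      P p beforeI + (P p J-I′ + c₁)  ≡⟨ cong (λ x → P p beforeI + (x + c₁)) balanced ⟨
      P p beforeI + (P p J-H′ + c₁)  ∎)
    where open ≤-Reasoning

  moved-J-H′ : ∀ {j c c₁} → CompletionTime p σ j c → CompletionTimeOn p J-H′ j c₁ →
    SwapEffect j c (P p beforeI + c₁)
  moved-J-H′ {c₁ = c₁} t t₁ with c₀ , t₀ , refl ← σ-time-J-H H′ t t₁ =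
    advanced (completionTimeOn⇒∈ p t₀) (begin
      P p beforeI + c₁          ≤⟨ +-monoʳ-≤ _ (completionTimeOn-≤ p t₁) ⟩
      P p beforeI + P p J-H′    ≤⟨ +-monoʳ-≤ _ (≤-trans (P-filterᵇ-≤ p H′ J-H) P-J-H-≤) ⟩
      P p beforeI + 2 * pmax²   ≤⟨ lead ⟩
      P p beforeH               ≤⟨ m≤m+n _ c₀ ⟩
      P p beforeH + c₀          ∎)
    where open ≤-Reasoning

  moved-J-I′ : ∀ {j c c₁} → CompletionTime p σ j c → CompletionTimeOn p J-I′ j c₁ →
    SwapEffect j c (P p beforeH + (P p J-H″ + c₁))
  moved-J-I′ t t₁ with c₀ , t₀ , refl ← σ-time-J-I I′ t t₁ =
    delayed (completionTimeOn⇒∈ p t₀) (begin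
      P p beforeI + c₀          ≤⟨ +-monoʳ-≤ _ (≤-trans (completionTimeOn-≤ p t₀) P-J-I-≤) ⟩
      P p beforeI + 2 * pmax²   ≤⟨ lead ⟩
      P p beforeH               ≤⟨ m≤m+n _ _ ⟩
      P p beforeH + _           ∎)
    where open ≤-Reasoning

  on-h : ∀ {j c c′} → CompletionTime p σ j c → CompletionTimeOn p (σ′ h) j c′ → SwapEffect j c c′
  on-h {j} {c′ = c′} t t′
    with completionTimeOn-++⁻ p beforeH (subst (λ L → CompletionTimeOn p L j c′) σ′-h t′)
  ... | inj₁ t₀ = unchanged (sym (σ-time t σ-h (completionTimeOn-++ˡ p t₀)))
  ... | inj₂ (_ , t₁ , refl) with completionTimeOn-++⁻ p J-H″ t₁
  ...   | inj₁ t₂ = kept-J-H″ t t₂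
  ...   | inj₂ (_ , t₂ , refl) with completionTimeOn-++⁻ p J-I′ t₂
  ...     | inj₁ t₃ = moved-J-I′ t t₃
  ...     | inj₂ (c₃ , t₃ , refl) = unchanged (begin
    P p beforeH + (P p J-H″ + (P p J-I′ + c₃))  ≡⟨ cong (P p beforeH +_) (+-assoc (P p J-H″) _ c₃) ⟨
    P p beforeH + (P p J-H″ + P p J-I′ + c₃)    ≡⟨ cong (λ x → P p beforeH + (x + c₃)) P-J-H″+P-J-I′ ⟩
    P p beforeH + (P p J-H + c₃)                ≡⟨ σ-time-afterH t t₃ ⟨
    _                                           ∎)
    where open ≡-Reasoning

  on-i : ∀ {j c c′} → CompletionTime p σ j c → CompletionTimeOn p (σ′ i) j c′ → SwapEffect j c c′
  on-i {j} {c′ = c′} t t′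
    with completionTimeOn-++⁻ p beforeI (subst (λ L → CompletionTimeOn p L j c′) σ′-i t′)
  ... | inj₁ t₀ = unchanged (sym (σ-time t σ-i (completionTimeOn-++ˡ p t₀)))
  ... | inj₂ (_ , t₁ , refl) with completionTimeOn-++⁻ p J-H′ t₁
  ...   | inj₁ t₂ = moved-J-H′ t t₂
  ...   | inj₂ (_ , t₂ , refl) with completionTimeOn-++⁻ p J-I″ t₂
  ...     | inj₁ t₃ = kept-J-I″ t t₃
  ...     | inj₂ (c₃ , t₃ , refl) = unchanged (begin
    P p beforeI + (P p J-H′ + (P p J-I″ + c₃))  ≡⟨ cong (P p beforeI +_) (+-assoc (P p J-H′) _ c₃) ⟨
    P p beforeI + (P p J-H′ + P p J-I″ + c₃)    ≡⟨ cong (λ x → P p beforeI + (x + c₃)) P-J-H′+P-J-I″ ⟩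
    P p beforeI + (P p J-I + c₃)                ≡⟨ σ-time-afterI t t₃ ⟨
    _                                           ∎)
    where open ≡-Reasoning

  swap-effect : ∀ {j c c′} → CompletionTime p σ j c → CompletionTime p σ′ j c′ → SwapEffect j c c′
  swap-effect {j} {c} {c′} t (k , t′) = by-machine (k ≟ h) (k ≟ i)
    where
    by-machine : Dec (k ≡ h) → Dec (k ≡ i) → SwapEffect j c c′
    by-machine (yes refl) _          = on-h t t′
    by-machine (no _)     (yes refl) = on-i t t′
    by-machine (no k≢h)   (no k≢i)   = unchanged (sym (σ-time t (sym (σ′-other k≢h k≢i)) t′))

  ∈-σ′-h : ∀ {j} → j ∈ beforeH ++ J-H″ ++ J-I′ ++ afterH → j ∈ σ′ h
  ∈-σ′-h {j} = subst (j ∈_) (sym σ′-h)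

  ∈-σ′-i : ∀ {j} → j ∈ beforeI ++ J-H′ ++ J-I″ ++ afterI → j ∈ σ′ i
  ∈-σ′-i {j} = subst (j ∈_) (sym σ′-i)

  σ′-covers-σ-h : ∀ {j} → j ∈ σ h → ∃ λ k → j ∈ σ′ k
  σ′-covers-σ-h {j} j∈ with ∈-++⁻ beforeH (subst (j ∈_) σ-h j∈)
  ... | inj₁ j∈b = h , ∈-σ′-h (∈-++⁺ˡ j∈b)
  ... | inj₂ j∈r with ∈-++⁻ J-H j∈r
  ...   | inj₂ j∈a = h , ∈-σ′-h (∈-++⁺ʳ beforeH (∈-++⁺ʳ J-H″ (∈-++⁺ʳ J-I′ j∈a)))
  ...   | inj₁ j∈J-H with ∈-filterᵇ-⊎ H′ j∈J-H
  ...     | inj₁ j∈J-H′ = i , ∈-σ′-i (∈-++⁺ʳ beforeI (∈-++⁺ˡ j∈J-H′))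
  ...     | inj₂ j∈J-H″ = h , ∈-σ′-h (∈-++⁺ʳ beforeH (∈-++⁺ˡ j∈J-H″))

  σ′-covers-σ-i : ∀ {j} → j ∈ σ i → ∃ λ k → j ∈ σ′ k
  σ′-covers-σ-i {j} j∈ with ∈-++⁻ beforeI (subst (j ∈_) σ-i j∈)
  ... | inj₁ j∈b = i , ∈-σ′-i (∈-++⁺ˡ j∈b)
  ... | inj₂ j∈r with ∈-++⁻ J-I j∈r
  ...   | inj₂ j∈a = i , ∈-σ′-i (∈-++⁺ʳ beforeI (∈-++⁺ʳ J-H′ (∈-++⁺ʳ J-I″ j∈a)))
  ...   | inj₁ j∈J-I with ∈-filterᵇ-⊎ I′ j∈J-I
  ...     | inj₁ j∈J-I′ = h , ∈-σ′-h (∈-++⁺ʳ beforeH (∈-++⁺ʳ J-H″ (∈-++⁺ˡ j∈J-I′)))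
  ...     | inj₂ j∈J-I″ = i , ∈-σ′-i (∈-++⁺ʳ beforeI (∈-++⁺ʳ J-H′ (∈-++⁺ˡ j∈J-I″)))

  σ′-covers : ∀ j → ∃ λ k → j ∈ σ′ k
  σ′-covers j with a j ≟ h | a j ≟ i
  ... | yes aj≡h | _        = σ′-covers-σ-h (subst (λ k → j ∈ σ k) aj≡h (∈-properSched a j))
  ... | no _     | yes aj≡i = σ′-covers-σ-i (subst (λ k → j ∈ σ k) aj≡i (∈-properSched a j))
  ... | no aj≢h  | no aj≢i  = a j , subst (j ∈_) (sym (σ′-other aj≢h aj≢i)) (∈-properSched a j)

  completionTime-σ′-exists : ∀ j → ∃ (CompletionTime p σ′ j)
  completionTime-σ′-exists j with k , j∈ ← σ′-covers j with c , t ← ∈⇒completionTimeOn p j∈ = c , k , t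

lemma4 : ∀ {m n} (p : Fin n → ℕ) → (∀ j → 1 ≤ p j)
    → (a : Fin n → Fin m) (j* : Fin n) (h i : Fin m)
    → Admissible p a j* h i
    → (H' I' : Fin n → Bool) → ValidChoice p a j* h i H' I'
    → (∀ j → ∃ λ c → CompletionTime p (properSched a) j c)
      × (∀ j → ∃ λ c' → CompletionTime p (intermediate p a j* h i H' I') j c')
      × (∀ j c c' → CompletionTime p (properSched a) j c
           → CompletionTime p (intermediate p a j* h i H' I') j c'
           → ((j ∉ JH p a j* h → j ∉ JI p a j* i → c' ≡ c)
              × (j ∈ JH p a j* h → c' ≤ c)
              × (j ∈ JI p a j* i → c ≤ c')))
lemma4 p p≥1 a j* h i (_ , _ , gap) H' I' (_ , _ , balanced) =
  completionTime-properSched-exists p a , completionTime-σ′-exists , λ _ _ _ → swap-effect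
  where open Swap p p≥1 a j* h i gap H' I' balanced
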